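{- For all $01$-structures $\mathbf H$, $\mathrm{Obs}^{\subset}_{\star}(\mathbf H)\neq\mathrm{Obs}^{\to}_{\star}(\mathbf H)$.
   Context: Fix a finite signature $\sigma$. Given a poset $(P,\preceq)$, a $(P,\sigma)$-structure $\mathbf G$ consists of a finite domain $G$ and, for each $R\in\sigma$ of arity $k$, a map $R^{\mathbf G}\colon G^k\to P$. A homomorphism $h\colon\mathbf G\to\mathbf H$ is a map $h\colon G\to H$ with $R^{\mathbf G}(\mathbf t)\preceq R^{\mathbf H}(h(\mathbf t))$ for all $R\in\sigma$ and tuples $\mathbf t$. $01$-structures are $(P_{01},\sigma)$-structures with $P_{01}=\{0,1\}$ ($0,1$ incomparable); $\star$-structures are $(P_\star,\sigma)$-structures with $P_\star=\{0,1,\star\}$, $0\preceq\star$, $1\preceq\star$, $0,1$ incomparable; every $01$-structure is a $\star$-structure. A $\star$-structure $\mathbf G$ is an inclusion-minimal obstruction for $\mathbf H$ if $\mathbf G\not\to\mathbf H$ and for every $v\in G$ the substructure induced by $G\setminus\{v\}$ maps to $\mathbf H$; $\mathrm{Obs}^\subset_\star(\mathbf H)$ is the set of these. A $\star$-structure $\mathbf G$ is a hom-minimal obstruction if $\mathbf G$ is a core (every endomorphism is an isomorphism), $\mathbf G\not\to\mathbf H$, and every $\star$-structure $\mathbf G'$ with $\mathbf G'\to\mathbf G$ and $\mathbf G\not\to\mathbf G'$ satisfies $\mathbf G'\to\mathbf H$; $\mathrm{Obs}^\to_\star(\mathbf H)$ is the set of these. -}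

module Defs where

open import Data.Nat using (ℕ; zero; suc)
open import Data.Fin using (Fin; zero; suc; punchIn)
open import Data.Vec using (Vec; map)
open import Data.Bool using (Bool; true; false)
open import Data.Product using (Σ; _×_; _,_)
open import Data.Empty using (⊥; ⊥-elim)
open import Data.Unit using (⊤)
open import Relation.Binary.PropositionalEquality using (_≡_)
open import Relation.Nullary using (¬_)

record Signature : Set where
  field
    nsym : ℕ
    ar   : Fin nsym → ℕ
open Signature public

-- Degenerate signatures (empty, or a single unary symbol) for which the
-- theorem is false.
Degenerate′ : (n : ℕ) → (Fin n → ℕ) → Set
Degenerate′ zero          _  = ⊤
Degenerate′ (suc zero)    a  = a zero ≡ 1
Degenerate′ (suc (suc _)) _  = ⊥

Degenerate : Signature → Set
Degenerate σ = Degenerate′ (nsym σ) (ar σ)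

data Star : Set where
  𝟘 𝟙 ★ : Star

data _⪯_ : Star → Star → Set where
  ⪯-refl : ∀ {x} → x ⪯ x
  𝟘⪯★    : 𝟘 ⪯ ★
  𝟙⪯★    : 𝟙 ⪯ ★

fromBool : Bool → Star
fromBool false = 𝟘
fromBool true  = 𝟙

module Sig (σ : Signature) where

  record Struct (P : Set) : Set where
    field
      size : ℕ
      rel  : (i : Fin (nsym σ)) → Vec (Fin size) (ar σ i) → P
  open Struct public

  StarStruct : Set
  StarStruct = Struct Star

  Struct01 : Set
  Struct01 = Struct Bool

  embed : Struct01 → StarStruct
  embed H = record { size = size H ; rel = λ i t → fromBool (rel H i t) }

  Hom : StarStruct → StarStruct → Set
  Hom G H = Σ (Fin (size G) → Fin (size H)) λ h →
              ∀ i (t : Vec (Fin (size G)) (ar σ i)) → rel G i t ⪯ rel H i (map h t)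

  _⟶_ : StarStruct → StarStruct → Set
  G ⟶ H = Hom G H

  IsIso : (G H : StarStruct) → Hom G H → Set
  IsIso G H (f , _) = Σ (Hom H G) λ where
    (g , _) → (∀ x → g (f x) ≡ x) × (∀ y → f (g y) ≡ y)

  IsCore : StarStruct → Set
  IsCore G = (e : Hom G G) → IsIso G G e

  delete′ : (m : ℕ) → ((i : Fin (nsym σ)) → Vec (Fin m) (ar σ i) → Star) →
            Fin m → StarStruct
  delete′ zero    r ()
  delete′ (suc m) r v = record { size = m ; rel = λ i t → r i (map (punchIn v) t) }

  delete : (G : StarStruct) → Fin (size G) → StarStruct
  delete G v = delete′ (size G) (rel G) v

  -- G ∈ Obs^⊂_★(H)
  InclMinObs : StarStruct → Struct01 → Set
  InclMinObs G H = ¬ (G ⟶ embed H) × (∀ v → delete G v ⟶ embed H)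

  -- G ∈ Obs^→_★(H)
  HomMinObs : StarStruct → Struct01 → Set
  HomMinObs G H = IsCore G × ¬ (G ⟶ embed H) ×
    (∀ (G′ : StarStruct) → G′ ⟶ G → ¬ (G ⟶ G′) → G′ ⟶ embed H)

{-# OPTIONS --safe #-}
-- A one-vertex structure with every relation ★ (or, if some symbol is
-- nullary, the empty structure whose nullary relations are ★) is an
-- inclusion-minimal obstruction: it does not map to the 01-structure H, yet
-- removing a vertex leaves nothing for ★ to sit on.  It is not a hom-minimal
-- obstruction, because ★ dominates everything: it receives a homomorphism from
-- a ★-structure strictly below it in the homomorphism order that still
-- contains a value H cannot match.
-- With a nullary symbol this is the empty structure disagreeing with H on
-- every nullary relation; otherwise it is a two-vertex structure with no
-- vertex that is ★ in every relation, which still carries some ★.  Finding the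
-- latter ★ is exactly where the non-degeneracy of the signature is used.
module Submission where

open import Defs
open import Data.Bool using (false; true; not)
open import Data.Empty using (⊥-elim)
open import Data.Fin using (Fin; zero; suc)
open import Data.Fin.Properties using (any?)
open import Data.Nat using (ℕ; zero; suc; _≟_)
open import Data.Product using (Σ-syntax; _×_; _,_; proj₁)
open import Data.Unit using (tt)
open import Data.Vec using (Vec; []; _∷_; map; replicate)
open import Data.Vec.Properties using (map-cong; map-replicate)
open import Relation.Binary.PropositionalEquality using (_≡_; _≢_; refl; sym; subst)
open import Relation.Nullary using (¬_; yes; no)

x⪯★ : ∀ x → x ⪯ ★
x⪯★ 𝟘 = 𝟘⪯★
x⪯★ 𝟙 = 𝟙⪯★
x⪯★ ★ = ⪯-refl

★⪯⇒≡★ : ∀ {x} → ★ ⪯ x → x ≡ ★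
★⪯⇒≡★ ⪯-refl = refl

★⋠fromBool : ∀ b → ¬ (★ ⪯ fromBool b)
★⋠fromBool false ()
★⋠fromBool true ()

fromBool-not⋠ : ∀ b → ¬ (fromBool (not b) ⪯ fromBool b)
fromBool-not⋠ false ()
fromBool-not⋠ true ()

Vec-Fin0⇒length≡0 : ∀ {k} → Vec (Fin 0) k → k ≡ 0
Vec-Fin0⇒length≡0 []      = refl
Vec-Fin0⇒length≡0 (() ∷ _)

module Obstructions (σ : Signature) where
  open Sig σ

  ObsCoincide : Struct01 → Set
  ObsCoincide H = ∀ (G : StarStruct) →
    (InclMinObs G H → HomMinObs G H) × (HomMinObs G H → InclMinObs G H)

  full★ : ℕ → StarStruct
  full★ n = record { size = n ; rel = λ _ _ → ★ }

  ⟶full★ : ∀ {n} (G : StarStruct) → (Fin (size G) → Fin n) → G ⟶ full★ n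
  ⟶full★ G f = f , λ _ _ → x⪯★ _

  ★↛embed : ∀ {G H} i t → rel G i t ≡ ★ → ¬ (G ⟶ embed H)
  ★↛embed {H = H} i t G[t]≡★ (h , hom) =
    ★⋠fromBool _ (subst (_⪯ fromBool (rel H i (map h t))) G[t]≡★ (hom i t))

  full★₁⟶⇒★-loop : ∀ {G} → full★ 1 ⟶ G →
    Σ[ x ∈ Fin (size G) ] ∀ i → rel G i (replicate (ar σ i) x) ≡ ★
  full★₁⟶⇒★-loop {G} (h , hom) = h zero , λ i →
    subst (λ t → rel G i t ≡ ★) (map-replicate h zero (ar σ i))
      (★⪯⇒≡★ (hom i (replicate (ar σ i) zero)))

  positive-arity⇒empty⟶ : (∀ i → ar σ i ≢ 0) →
    ∀ {r K} → record { size = 0 ; rel = r } ⟶ K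
  positive-arity⇒empty⟶ positive = (λ ()) , λ i t → ⊥-elim (positive i (Vec-Fin0⇒length≡0 t))

  full★₁-InclMinObs : (H : Struct01) → Fin (nsym σ) → (∀ i → ar σ i ≢ 0) →
    InclMinObs (full★ 1) H
  full★₁-InclMinObs H i positive = ★↛embed {H = H} i (replicate _ zero) refl
                                 , λ { zero → positive-arity⇒empty⟶ positive {K = embed H} }

  smaller-nonobs⇒¬HomMinObs : ∀ {G H} G′ → G′ ⟶ G → ¬ (G ⟶ G′) → ¬ (G′ ⟶ embed H) →
    ¬ HomMinObs G H
  smaller-nonobs⇒¬HomMinObs G′ G′⟶G G↛G′ G′↛H (_ , _ , minimal) = G′↛H (minimal G′ G′⟶G G↛G′)

  InclMinObs∧¬HomMinObs⇒¬ObsCoincide : ∀ {G H} → InclMinObs G H → ¬ HomMinObs G H →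
    ¬ ObsCoincide H
  InclMinObs∧¬HomMinObs⇒¬ObsCoincide {G} incl ¬hom coincide = ¬hom (proj₁ (coincide G) incl)

  module Nullary (H : Struct01) (c : Fin (nsym σ)) (c-nullary : ar σ c ≡ 0) where

    emptyTuple : Vec (Fin 0) (ar σ c)
    emptyTuple = subst (Vec (Fin 0)) (sym c-nullary) []

    flippedEmptyPart : StarStruct
    flippedEmptyPart = record
      { size = 0 ; rel = λ i t → fromBool (not (rel H i (map (λ ()) t))) }

    flippedEmptyPart↛H : ¬ (flippedEmptyPart ⟶ embed H)
    flippedEmptyPart↛H (h , hom) = fromBool-not⋠ _
      (subst (λ t → _ ⪯ fromBool (rel H c t)) (map-cong (λ ()) emptyTuple) (hom c emptyTuple))

    full★₀↛flippedEmptyPart : ¬ (full★ 0 ⟶ flippedEmptyPart)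
    full★₀↛flippedEmptyPart (h , hom) = ★⋠fromBool _ (hom c emptyTuple)

    full★₀-InclMinObs : InclMinObs (full★ 0) H
    full★₀-InclMinObs = ★↛embed {H = H} c emptyTuple refl , λ ()

    ¬coincide : ¬ ObsCoincide H
    ¬coincide = InclMinObs∧¬HomMinObs⇒¬ObsCoincide {H = H} full★₀-InclMinObs
      (smaller-nonobs⇒¬HomMinObs {H = H} flippedEmptyPart (⟶full★ flippedEmptyPart λ ())
        full★₀↛flippedEmptyPart flippedEmptyPart↛H)

apart : Fin 2 → Fin 2 → Star
apart zero       zero       = 𝟘
apart (suc zero) (suc zero) = 𝟘
apart _          _          = ★

apartHead : ∀ {k} → Vec (Fin 2) k → Star
apartHead (x ∷ y ∷ _) = apart x y
apartHead _           = 𝟘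

apartHead-replicate : ∀ k x → apartHead (replicate k x) ≡ 𝟘
apartHead-replicate zero          _          = refl
apartHead-replicate (suc zero)    _          = refl
apartHead-replicate (suc (suc k)) zero       = refl
apartHead-replicate (suc (suc k)) (suc zero) = refl

apartHead-★ : ∀ k → k ≢ 0 → k ≢ 1 → Σ[ t ∈ Vec (Fin 2) k ] apartHead t ≡ ★
apartHead-★ zero          k≢0 _   = ⊥-elim (k≢0 refl)
apartHead-★ (suc zero)    _   k≢1 = ⊥-elim (k≢1 refl)
apartHead-★ (suc (suc k)) _   _   = zero ∷ suc zero ∷ replicate k zero , refl

-- Relation zero is 𝟘 on constant tuples, so full★ 1 cannot map here.
separator : (m : ℕ) (a : Fin (suc m) → ℕ) → Sig.StarStruct (record { nsym = suc m ; ar = a })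
separator m a = record { size = 2 ; rel = λ { zero t → apartHead t ; (suc _) _ → ★ } }

separator-★ : ∀ m a → ¬ Degenerate′ (suc m) a → (∀ i → a i ≢ 0) →
  Σ[ i ∈ Fin (suc m) ] Σ[ t ∈ Vec (Fin 2) (a i) ] Sig.rel (separator m a) i t ≡ ★
separator-★ (suc _) a _             _        = suc zero , replicate _ zero , refl
separator-★ zero    a nondegenerate positive = zero , apartHead-★ (a zero) (positive zero) nondegenerate

module PositiveArity (m : ℕ) (a : Fin (suc m) → ℕ) where
  σ : Signature
  σ = record { nsym = suc m ; ar = a }
  open Sig σ
  open Obstructions σ

  full★₁↛separator : ¬ (full★ 1 ⟶ separator m a)
  full★₁↛separator hom with full★₁⟶⇒★-loop {G = separator m a} hom
  ... | x , loop with subst (_≡ ★) (apartHead-replicate (a zero) x) (loop zero)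
  ... | ()

  ¬coincide : ¬ Degenerate σ → (H : Struct01) → (∀ i → a i ≢ 0) → ¬ ObsCoincide H
  ¬coincide nondegenerate H positive with separator-★ m a nondegenerate positive
  ... | i , t , separator[t]≡★ =
    InclMinObs∧¬HomMinObs⇒¬ObsCoincide {H = H} (full★₁-InclMinObs H zero positive)
      (smaller-nonobs⇒¬HomMinObs {H = H} (separator m a) (⟶full★ (separator m a) λ _ → zero)
        full★₁↛separator (★↛embed {H = H} i t separator[t]≡★))

positive-arity⇒¬ObsCoincide : (n : ℕ) (a : Fin n → ℕ) → ¬ Degenerate′ n a →
  (H : Sig.Struct01 (record { nsym = n ; ar = a })) → (∀ i → a i ≢ 0) →
  ¬ Obstructions.ObsCoincide (record { nsym = n ; ar = a }) H
positive-arity⇒¬ObsCoincide zero    a nondegenerate = ⊥-elim (nondegenerate tt)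
positive-arity⇒¬ObsCoincide (suc m) a nondegenerate = PositiveArity.¬coincide m a nondegenerate

mainTheorem12 : (σ : Signature) → ¬ Degenerate σ → (H : Sig.Struct01 σ) →
    ¬ (∀ (G : Sig.StarStruct σ) →
         (Sig.InclMinObs σ G H → Sig.HomMinObs σ G H) × (Sig.HomMinObs σ G H → Sig.InclMinObs σ G H))
mainTheorem12 σ nondegenerate H with any? (λ i → ar σ i ≟ 0)
... | yes (c , c-nullary) = Obstructions.Nullary.¬coincide σ H c c-nullary
... | no no-nullary       =
  positive-arity⇒¬ObsCoincide (nsym σ) (ar σ) nondegenerate H (λ i i-nullary → no-nullary (i , i-nullary))
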